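{- Let $\mathbf A=\langle A,\wedge,\vee,\cdot,1,0,{\sim},{ - },'\rangle$ be a quasi relation algebra. For $a\in A$ and $n\in\omega$ define $a^{\triangledown n}={\sim}^{2n}(a')$ and $a^{\vartriangle n}={ - }^{2n}(a')$. Then $\mathbf A^{\triangledown n}=\langle A,\wedge,\vee,\cdot,1,0,{\sim},{ - },{}^{\triangledown n}\rangle$ and $\mathbf A^{\vartriangle n}=\langle A,\wedge,\vee,\cdot,1,0,{\sim},{ - },{}^{\vartriangle n}\rangle$ are quasi relation algebras for every $n\in\omega$.
   Context: A quasi relation algebra (qRA) $\langle A,\wedge,\vee,\cdot,1,0,{\sim},{ - },'\rangle$: $\langle A,\wedge,\vee\rangle$ is a lattice, $\langle A,\cdot,1\rangle$ a monoid, there are residuals with $a\cdot b\le c\iff a\le c/b\iff b\le a\backslash c$, $0\in A$ is arbitrary, ${\sim}a=a\backslash 0$, ${ - }a=0/a$, and ${\sim}{ - }a={ - }{\sim}a=a$ for all $a$ (involutive); $a+b:={\sim}({ - }b\cdot{ - }a)$; $'$ is a unary operation with $a''=a$, $(a\vee b)'=a'\wedge b'$, $({\sim}a)'={ - }(a')$ and $(a\cdot b)'=a'+b'$. ${\sim}^n a$ and ${ - }^n a$ denote $n$-fold applications. -}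

module Defs where

open import Level using (Level) renaming (suc to lsuc)
open import Data.Nat as ℕ using (ℕ; _*_)
open import Data.Product using (Σ; _×_; _,_)
open import Function.Bundles using (_⇔_)
open import Relation.Binary.PropositionalEquality using (_≡_)
open import Algebra.Lattice.Structures using (IsLattice)
open import Algebra.Structures using (IsMonoid)

iter : ∀ {a} {A : Set a} → ℕ → (A → A) → A → A
iter ℕ.zero    f x = x
iter (ℕ.suc n) f x = f (iter n f x)

record QRASig (ℓ : Level) : Set (lsuc ℓ) where
  field
    Carrier : Set ℓ
    _∧_ _∨_ _·_ : Carrier → Carrier → Carrier
    one nought : Carrier
    ∼_ -_ _′ : Carrier → Carrier

withPrime : ∀ {ℓ} (S : QRASig ℓ) → (QRASig.Carrier S → QRASig.Carrier S) → QRASig ℓ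
withPrime S p = record
  { Carrier = Carrier ; _∧_ = _∧_ ; _∨_ = _∨_ ; _·_ = _·_
  ; one = one ; nought = nought ; ∼_ = ∼_ ; -_ = -_ ; _′ = p }
  where open QRASig S

record IsQRA {ℓ} (S : QRASig ℓ) : Set ℓ where
  open QRASig S
  _≤_ : Carrier → Carrier → Set ℓ
  a ≤ b = (a ∧ b) ≡ a
  _+_ : Carrier → Carrier → Carrier
  a + b = ∼ ((- b) · (- a))
  field
    isLattice : IsLattice _≡_ _∨_ _∧_
    isMonoid  : IsMonoid _≡_ _·_ one
    _\\_ _//_ : Carrier → Carrier → Carrier
    residuation : ∀ a b c → ((a · b) ≤ c ⇔ a ≤ (c // b)) × ((a · b) ≤ c ⇔ b ≤ (a \\ c))
    tilde-def : ∀ a → ∼ a ≡ a \\ nought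
    minus-def : ∀ a → - a ≡ nought // a
    involutive₁ : ∀ a → ∼ (- a) ≡ a
    involutive₂ : ∀ a → - (∼ a) ≡ a
    ′-invol : ∀ a → (a ′) ′ ≡ a
    ′-∨ : ∀ a b → (a ∨ b) ′ ≡ (a ′) ∧ (b ′)
    ′-∼ : ∀ a → (∼ a) ′ ≡ - (a ′)
    ′-· : ∀ a b → (a · b) ′ ≡ (a ′) + (b ′)

▽ : ∀ {ℓ} (S : QRASig ℓ) → ℕ → QRASig.Carrier S → QRASig.Carrier S
▽ S n a = iter (2 * n) (QRASig.∼_ S) (QRASig._′ S a)

△ : ∀ {ℓ} (S : QRASig ℓ) → ℕ → QRASig.Carrier S → QRASig.Carrier S
△ S n a = iter (2 * n) (QRASig.-_ S) (QRASig._′ S a)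

-- Write ∼² = ∼∼ and -² = --. They are mutually inverse automorphisms of the reduct
-- ⟨A, ∧, ·, ∼, -⟩ (multiplicativity of ∼² is the identity x + y = -(∼y · ∼x)), and
-- (∼² a)′ = -²(a′). For every endomorphism σ of that reduct with σ((σ a)′) = a′, the map
-- a ↦ σ(a′) satisfies the axioms of ′; both conditions pass to iterates, and
-- a^{▽n} = (∼²)ⁿ(a′), a^{△n} = (-²)ⁿ(a′).
module Submission where

open import Defs
open import Data.Nat using (ℕ; zero; suc; _*_)
open import Data.Nat.Properties using (*-suc)
open import Data.Product using (_×_; _,_; proj₁; proj₂)
open import Data.Product.Function.NonDependent.Propositional using (_×-⇔_)
open import Function.Base using (_∘_)
open import Function.Bundles using (_⇔_; mk⇔; Equivalence)
open import Function.Properties.Equivalence using (⇔-setoid)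
open import Relation.Binary.PropositionalEquality
  using (_≡_; refl; sym; trans; cong; cong₂; module ≡-Reasoning)
import Relation.Binary.Reasoning.Setoid as SetoidReasoning
open import Algebra.Lattice.Bundles using (Lattice)
open import Algebra.Lattice.Structures using (IsLattice)
import Algebra.Lattice.Properties.Lattice as LatticeProperties
open import Algebra.Structures using (IsMonoid)

module _ {a} {A : Set a} where

  iter-sucʳ : ∀ n (f : A → A) x → iter (suc n) f x ≡ iter n f (f x)
  iter-sucʳ zero    f x = refl
  iter-sucʳ (suc n) f x = cong f (iter-sucʳ n f x)

  iter-2* : ∀ n (f : A → A) x → iter (2 * n) f x ≡ iter n (f ∘ f) x
  iter-2* zero    f x = refl
  iter-2* (suc n) f x = trans (cong (λ k → iter k f x) (*-suc 2 n)) (cong (f ∘ f) (iter-2* n f x))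

  iter-homo₁ : ∀ {f : A → A} (g : A → A) → (∀ x → f (g x) ≡ g (f x)) →
               ∀ n x → iter n f (g x) ≡ g (iter n f x)
  iter-homo₁ g homo zero    x = refl
  iter-homo₁ {f} g homo (suc n) x = trans (cong f (iter-homo₁ g homo n x)) (homo _)

  iter-homo₂ : ∀ {f : A → A} (_∙_ : A → A → A) → (∀ x y → f (x ∙ y) ≡ f x ∙ f y) →
               ∀ n x y → iter n f (x ∙ y) ≡ iter n f x ∙ iter n f y
  iter-homo₂ _∙_ homo zero    x y = refl
  iter-homo₂ {f} _∙_ homo (suc n) x y = trans (cong f (iter-homo₂ _∙_ homo n x y)) (homo _ _)

  inverse-homo₂ : ∀ {f g : A → A} (_∙_ : A → A → A) →
                  (∀ x → f (g x) ≡ x) → (∀ x → g (f x) ≡ x) →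
                  (∀ x y → f (x ∙ y) ≡ f x ∙ f y) → ∀ x y → g (x ∙ y) ≡ g x ∙ g y
  inverse-homo₂ {f} {g} _∙_ fg gf homo x y = begin
    g (x ∙ y)                 ≡⟨ cong g (sym (cong₂ _∙_ (fg x) (fg y))) ⟩
    g (f (g x) ∙ f (g y))     ≡⟨ cong g (sym (homo (g x) (g y))) ⟩
    g (f (g x ∙ g y))         ≡⟨ gf (g x ∙ g y) ⟩
    g x ∙ g y                 ∎
    where open ≡-Reasoning

module QRAProperties {ℓ} (S : QRASig ℓ) (Q : IsQRA S) where
  open QRASig S
  open IsQRA Q
  open IsLattice isLattice using (∧-comm; ∧-assoc)
  open IsMonoid isMonoid using (assoc)

  private
    module ⇔-Reasoning = SetoidReasoning (⇔-setoid ℓ)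

    lattice : Lattice ℓ ℓ
    lattice = record
      { Carrier = Carrier ; _≈_ = _≡_ ; _∨_ = _∨_ ; _∧_ = _∧_ ; isLattice = isLattice }

  open LatticeProperties lattice using (∧-idem)

  ≤-refl : ∀ x → x ≤ x
  ≤-refl = ∧-idem

  ≤-antisym : ∀ {x y} → x ≤ y → y ≤ x → x ≡ y
  ≤-antisym {x} {y} x≤y y≤x = trans (sym x≤y) (trans (∧-comm x y) y≤x)

  ≤-∧ : ∀ {z x y} → z ≤ (x ∧ y) ⇔ (z ≤ x × z ≤ y)
  ≤-∧ {z} {x} {y} = mk⇔ (λ p → lower p refl , lower p (∧-comm x y)) greatest
    where
    lower : ∀ {u v} → z ≤ (x ∧ y) → x ∧ y ≡ u ∧ v → z ≤ u
    lower {u} {v} p e = begin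
      z ∧ u                  ≡⟨ cong (_∧ u) (sym p) ⟩
      (z ∧ (x ∧ y)) ∧ u      ≡⟨ ∧-assoc z (x ∧ y) u ⟩
      z ∧ ((x ∧ y) ∧ u)      ≡⟨ cong (λ t → z ∧ (t ∧ u)) e ⟩
      z ∧ ((u ∧ v) ∧ u)      ≡⟨ cong (z ∧_) (trans (∧-comm (u ∧ v) u) (sym (∧-assoc u u v))) ⟩
      z ∧ ((u ∧ u) ∧ v)      ≡⟨ cong (λ t → z ∧ (t ∧ v)) (∧-idem u) ⟩
      z ∧ (u ∧ v)            ≡⟨ cong (z ∧_) (sym e) ⟩
      z ∧ (x ∧ y)            ≡⟨ p ⟩
      z                      ∎
      where open ≡-Reasoning
    greatest : z ≤ x × z ≤ y → z ≤ (x ∧ y)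
    greatest (p , q) = trans (sym (∧-assoc z x y)) (trans (cong (_∧ y) p) q)

  ≤-ext : ∀ {u v} → (∀ z → z ≤ u ⇔ z ≤ v) → u ≡ v
  ≤-ext {u} {v} iff =
    ≤-antisym (Equivalence.to (iff u) (≤-refl u)) (Equivalence.from (iff v) (≤-refl v))

  tilde-residual : ∀ a b → ((a · b) ≤ nought) ⇔ (b ≤ (∼ a))
  tilde-residual a b = begin
    (a · b) ≤ nought        ≈⟨ proj₂ (residuation a b nought) ⟩
    b ≤ (a \\ nought)       ≡⟨ cong (b ≤_) (sym (tilde-def a)) ⟩
    b ≤ (∼ a)               ∎
    where open ⇔-Reasoning

  minus-residual : ∀ a b → ((a · b) ≤ nought) ⇔ (a ≤ (- b))
  minus-residual a b = begin
    (a · b) ≤ nought        ≈⟨ proj₁ (residuation a b nought) ⟩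
    a ≤ (nought // b)       ≡⟨ cong (a ≤_) (sym (minus-def b)) ⟩
    a ≤ (- b)               ∎
    where open ⇔-Reasoning

  galois : ∀ a b → (a ≤ (- b)) ⇔ (b ≤ (∼ a))
  galois a b = begin
    a ≤ (- b)               ≈⟨ minus-residual a b ⟨
    (a · b) ≤ nought        ≈⟨ tilde-residual a b ⟩
    b ≤ (∼ a)               ∎
    where open ⇔-Reasoning

  minus-antitone : ∀ x y → (x ≤ y) ⇔ ((- y) ≤ (- x))
  minus-antitone x y = begin
    x ≤ y                   ≡⟨ cong (x ≤_) (sym (involutive₁ y)) ⟩
    x ≤ (∼ (- y))           ≈⟨ galois (- y) x ⟨
    (- y) ≤ (- x)           ∎
    where open ⇔-Reasoning

  ≤-∼∼ : ∀ z w → (z ≤ (∼ (∼ w))) ⇔ ((- (- z)) ≤ w)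
  ≤-∼∼ z w = begin
    z ≤ (∼ (∼ w))           ≈⟨ galois (∼ w) z ⟨
    (∼ w) ≤ (- z)           ≈⟨ minus-antitone (∼ w) (- z) ⟩
    (- (- z)) ≤ (- (∼ w))   ≡⟨ cong ((- (- z)) ≤_) (involutive₂ w) ⟩
    (- (- z)) ≤ w           ∎
    where open ⇔-Reasoning

  rotate : ∀ a b → (((- a) · b) ≤ nought) ⇔ ((b · (∼ a)) ≤ nought)
  rotate a b = begin
    ((- a) · b) ≤ nought    ≈⟨ tilde-residual (- a) b ⟩
    b ≤ (∼ (- a))           ≡⟨ cong (b ≤_) (trans (involutive₁ a) (sym (involutive₂ a))) ⟩
    b ≤ (- (∼ a))           ≈⟨ minus-residual b (∼ a) ⟨
    (b · (∼ a)) ≤ nought    ∎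
    where open ⇔-Reasoning

  +-as-minus : ∀ x y → x + y ≡ - ((∼ y) · (∼ x))
  +-as-minus x y = ≤-ext λ z → begin
    z ≤ (x + y)                           ≈⟨ tilde-residual ((- y) · (- x)) z ⟨
    (((- y) · (- x)) · z) ≤ nought        ≡⟨ cong (_≤ nought) (assoc (- y) (- x) z) ⟩
    ((- y) · ((- x) · z)) ≤ nought        ≈⟨ rotate y ((- x) · z) ⟩
    (((- x) · z) · (∼ y)) ≤ nought        ≡⟨ cong (_≤ nought) (assoc (- x) z (∼ y)) ⟩
    ((- x) · (z · (∼ y))) ≤ nought        ≈⟨ rotate x (z · (∼ y)) ⟩
    ((z · (∼ y)) · (∼ x)) ≤ nought        ≡⟨ cong (_≤ nought) (assoc z (∼ y) (∼ x)) ⟩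
    (z · ((∼ y) · (∼ x))) ≤ nought        ≈⟨ minus-residual z ((∼ y) · (∼ x)) ⟩
    z ≤ (- ((∼ y) · (∼ x)))               ∎
    where open ⇔-Reasoning

  ∼² -² : Carrier → Carrier
  ∼² a = ∼ (∼ a)
  -² a = - (- a)

  ∼²∘-² : ∀ a → ∼² (-² a) ≡ a
  ∼²∘-² a = trans (cong ∼_ (involutive₁ (- a))) (involutive₁ a)

  -²∘∼² : ∀ a → -² (∼² a) ≡ a
  -²∘∼² a = trans (cong -_ (involutive₂ (∼ a))) (involutive₂ a)

  ∼²-∧ : ∀ x y → ∼² (x ∧ y) ≡ ∼² x ∧ ∼² y
  ∼²-∧ x y = ≤-ext λ z → begin
    z ≤ ∼² (x ∧ y)                ≈⟨ ≤-∼∼ z (x ∧ y) ⟩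
    -² z ≤ (x ∧ y)                ≈⟨ ≤-∧ ⟩
    (-² z ≤ x × -² z ≤ y)         ≈⟨ ≤-∼∼ z x ×-⇔ ≤-∼∼ z y ⟨
    (z ≤ ∼² x × z ≤ ∼² y)         ≈⟨ ≤-∧ ⟨
    z ≤ (∼² x ∧ ∼² y)             ∎
    where open ⇔-Reasoning

  ∼²-· : ∀ x y → ∼² (x · y) ≡ ∼² x · ∼² y
  ∼²-· x y = begin
    ∼ (∼ (x · y))                      ≡⟨ cong (∼_ ∘ ∼_) (sym (cong₂ _·_ (involutive₂ x) (involutive₂ y))) ⟩
    ∼ ((∼ y) + (∼ x))                  ≡⟨ cong ∼_ (+-as-minus (∼ y) (∼ x)) ⟩
    ∼ (- (∼² x · ∼² y))                ≡⟨ involutive₁ (∼² x · ∼² y) ⟩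
    ∼² x · ∼² y                        ∎
    where open ≡-Reasoning

  ′-minus : ∀ a → (- a) ′ ≡ ∼ (a ′)
  ′-minus a = begin
    (- a) ′                  ≡⟨ sym (involutive₁ ((- a) ′)) ⟩
    ∼ (- ((- a) ′))          ≡⟨ cong ∼_ (sym (′-∼ (- a))) ⟩
    ∼ ((∼ (- a)) ′)          ≡⟨ cong (λ t → ∼ (t ′)) (involutive₁ a) ⟩
    ∼ (a ′)                  ∎
    where open ≡-Reasoning

  record IsEndomorphism (σ : Carrier → Carrier) : Set ℓ where
    field
      ∧-homo     : ∀ x y → σ (x ∧ y) ≡ σ x ∧ σ y
      ·-homo     : ∀ x y → σ (x · y) ≡ σ x · σ y
      ∼-homo     : ∀ x → σ (∼ x) ≡ ∼ (σ x)
      minus-homo : ∀ x → σ (- x) ≡ - (σ x)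

  -- Equivalently, σ is invertible with σ⁻¹ = ′ ∘ σ ∘ ′.
  InvertedBy′ : (Carrier → Carrier) → Set ℓ
  InvertedBy′ σ = ∀ a → σ ((σ a) ′) ≡ a ′

  ∼²-isEndomorphism : IsEndomorphism ∼²
  ∼²-isEndomorphism = record
    { ∧-homo     = ∼²-∧
    ; ·-homo     = ∼²-·
    ; ∼-homo     = λ _ → refl
    ; minus-homo = λ x → trans (cong ∼_ (involutive₁ x)) (sym (involutive₂ (∼ x)))
    }

  -²-isEndomorphism : IsEndomorphism -²
  -²-isEndomorphism = record
    { ∧-homo     = inverse-homo₂ _∧_ ∼²∘-² -²∘∼² ∼²-∧
    ; ·-homo     = inverse-homo₂ _·_ ∼²∘-² -²∘∼² ∼²-·
    ; ∼-homo     = λ x → trans (cong -_ (involutive₂ x)) (sym (involutive₁ (- x)))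
    ; minus-homo = λ _ → refl
    }

  ∼²-invertedBy′ : InvertedBy′ ∼²
  ∼²-invertedBy′ a = trans (cong ∼² (trans (′-∼ (∼ a)) (cong -_ (′-∼ a)))) (∼²∘-² (a ′))

  -²-invertedBy′ : InvertedBy′ -²
  -²-invertedBy′ a = trans (cong -² (trans (′-minus (- a)) (cong ∼_ (′-minus a)))) (-²∘∼² (a ′))

  iter-isEndomorphism : ∀ {σ} → IsEndomorphism σ → ∀ n → IsEndomorphism (iter n σ)
  iter-isEndomorphism σ-endo n = record
    { ∧-homo     = iter-homo₂ _∧_ ∧-homo n
    ; ·-homo     = iter-homo₂ _·_ ·-homo n
    ; ∼-homo     = iter-homo₁ ∼_ ∼-homo n
    ; minus-homo = iter-homo₁ -_ minus-homo n
    }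
    where open IsEndomorphism σ-endo

  iter-invertedBy′ : ∀ {σ} → InvertedBy′ σ → ∀ n → InvertedBy′ (iter n σ)
  iter-invertedBy′ σ-inv zero    a = refl
  iter-invertedBy′ {σ} σ-inv (suc n) a = begin
    σ (iter n σ ((σ (iter n σ a)) ′))    ≡⟨ iter-sucʳ n σ _ ⟩
    iter n σ (σ ((σ (iter n σ a)) ′))    ≡⟨ cong (iter n σ) (σ-inv (iter n σ a)) ⟩
    iter n σ ((iter n σ a) ′)            ≡⟨ iter-invertedBy′ σ-inv n a ⟩
    a ′                                  ∎
    where open ≡-Reasoning

  twisted-isQRA : ∀ {σ} → IsEndomorphism σ → InvertedBy′ σ →
                  (p : Carrier → Carrier) → (∀ a → p a ≡ σ (a ′)) → IsQRA (withPrime S p)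
  twisted-isQRA {σ} σ-endo σ-inv p p≗σ′ = record
    { isLattice   = isLattice
    ; isMonoid    = isMonoid
    ; _\\_        = _\\_
    ; _//_        = _//_
    ; residuation = residuation
    ; tilde-def   = tilde-def
    ; minus-def   = minus-def
    ; involutive₁ = involutive₁
    ; involutive₂ = involutive₂
    ; ′-invol     = p-invol
    ; ′-∨         = p-∨
    ; ′-∼         = p-∼
    ; ′-·         = p-·
    }
    where
    open IsEndomorphism σ-endo
    open ≡-Reasoning

    p-invol : ∀ a → p (p a) ≡ a
    p-invol a = begin
      p (p a)                ≡⟨ p≗σ′ (p a) ⟩
      σ ((p a) ′)            ≡⟨ cong (λ t → σ (t ′)) (p≗σ′ a) ⟩
      σ ((σ (a ′)) ′)        ≡⟨ σ-inv (a ′) ⟩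
      (a ′) ′                ≡⟨ ′-invol a ⟩
      a                      ∎

    p-∨ : ∀ a b → p (a ∨ b) ≡ p a ∧ p b
    p-∨ a b = begin
      p (a ∨ b)              ≡⟨ p≗σ′ (a ∨ b) ⟩
      σ ((a ∨ b) ′)          ≡⟨ cong σ (′-∨ a b) ⟩
      σ ((a ′) ∧ (b ′))      ≡⟨ ∧-homo (a ′) (b ′) ⟩
      σ (a ′) ∧ σ (b ′)      ≡⟨ sym (cong₂ _∧_ (p≗σ′ a) (p≗σ′ b)) ⟩
      p a ∧ p b              ∎

    p-∼ : ∀ a → p (∼ a) ≡ - (p a)
    p-∼ a = begin
      p (∼ a)                ≡⟨ p≗σ′ (∼ a) ⟩
      σ ((∼ a) ′)            ≡⟨ cong σ (′-∼ a) ⟩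
      σ (- (a ′))            ≡⟨ minus-homo (a ′) ⟩
      - σ (a ′)              ≡⟨ sym (cong -_ (p≗σ′ a)) ⟩
      - (p a)                ∎

    p-· : ∀ a b → p (a · b) ≡ ∼ ((- p b) · (- p a))
    p-· a b = begin
      p (a · b)                          ≡⟨ p≗σ′ (a · b) ⟩
      σ ((a · b) ′)                      ≡⟨ cong σ (′-· a b) ⟩
      σ (∼ ((- (b ′)) · (- (a ′))))      ≡⟨ ∼-homo _ ⟩
      ∼ σ ((- (b ′)) · (- (a ′)))        ≡⟨ cong ∼_ (·-homo _ _) ⟩
      ∼ (σ (- (b ′)) · σ (- (a ′)))      ≡⟨ cong ∼_ (cong₂ _·_ (minus-homo (b ′)) (minus-homo (a ′))) ⟩
      ∼ ((- σ (b ′)) · (- σ (a ′)))      ≡⟨ sym (cong ∼_ (cong₂ _·_ (cong -_ (p≗σ′ b)) (cong -_ (p≗σ′ a)))) ⟩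
      ∼ ((- p b) · (- p a))              ∎

  ▽-isQRA : ∀ n → IsQRA (withPrime S (▽ S n))
  ▽-isQRA n = twisted-isQRA (iter-isEndomorphism ∼²-isEndomorphism n)
    (iter-invertedBy′ ∼²-invertedBy′ n) (▽ S n) (λ a → iter-2* n ∼_ (a ′))

  △-isQRA : ∀ n → IsQRA (withPrime S (△ S n))
  △-isQRA n = twisted-isQRA (iter-isEndomorphism -²-isEndomorphism n)
    (iter-invertedBy′ -²-invertedBy′ n) (△ S n) (λ a → iter-2* n -_ (a ′))

theorem2p5 : ∀ {ℓ} (S : QRASig ℓ) → IsQRA S → (n : ℕ) →
    IsQRA (withPrime S (▽ S n)) × IsQRA (withPrime S (△ S n))
theorem2p5 S Q n = ▽-isQRA n , △-isQRA n
  where open QRAProperties S Q
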